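{- Let $T$ be a theory and $s,t$ terms with $[s]=[t]$. Then for each formula $A$ and variable $w$, $T\vdash_{\mathsf{SE}} A[w/s]$ if and only if $T\vdash_{\mathsf{SE}} A[w/t]$.
   Context: Syntax of $\mathsf{SE}$. There are countably infinite sets of justification constants $\mathsf{JConst}=\{0,1,c_1,c_2,\dots\}$ and justification variables $\mathsf{JVar}$. Terms: constants, variables, and $s\cdot t$, $s+t$ for terms $s,t$. Formulas: $\bot$, atomic propositions $P\in\mathsf{Prop}$, $A\to B$, and $t:A$; $\neg,\wedge,\vee,\leftrightarrow$ are abbreviations. $A[w/t]$ is simultaneous replacement of the variable $w$ by term $t$. Axioms of $\mathsf{SE}$ (for arbitrary formulas $A,B$ and variables $w,x,y,z$): (CL) propositional tautologies; (j) $x:(A\to B)\to(y:A\to x\cdot y:B)$; (j+) $x:A\wedge y:A\to(x+y):A$; (a+) $A[w/(x+y)+z]\to A[w/x+(y+z)]$; (c+) $A[w/x+y]\to A[w/y+x]$; (0+) $A[w/x+0]\leftrightarrow A[w/x]$; (am) $A[w/(x\cdot y)\cdot z]\leftrightarrow A[w/x\cdot(y\cdot z)]$; (a0) $A[w/x\cdot 0]\leftrightarrow A[w/0]$, $A[w/0\cdot x]\leftrightarrow A[w/0]$; (a1) $A[w/x\cdot 1]\leftrightarrow A[w/x]$, $A[w/1\cdot x]\leftrightarrow A[w/x]$; (dl) $A[w/x\cdot(y+z)]\leftrightarrow A[w/x\cdot y+x\cdot z]$; (dr) $A[w/(y+z)\cdot x]\leftrightarrow A[w/y\cdot x+z\cdot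 x]$. Rules: modus ponens and (jv): from $A$ infer $A[x/t]$. $T\vdash_{\mathsf{SE}}F$ means $F$ is derivable from axioms and members of the set $T$ by these rules. For a term $t$, $[t]$ denotes its equivalence class modulo the semiring equalities, i.e., its image in the free semiring over $\mathsf{JConst}\cup\mathsf{JVar}$ (with $0,1$ as the semiring zero and one; $+$ associative, commutative with neutral $0$; $\cdot$ associative, not necessarily commutative, with neutral $1$; both distributive laws; $0$ absorbing for $\cdot$). So $[s]=[t]$ means $s=t$ follows from the semiring axioms. -}

module Defs where

open import Data.Nat using (ℕ; _≡ᵇ_)
open import Data.Bool using (Bool; true; false; if_then_else_; _∧_; not; _∨_)
open import Relation.Binary.PropositionalEquality using (_≡_)

JVar : Set
JVar = ℕ

data Term : Set where
  𝟘   : Term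
  𝟙   : Term
  cst : ℕ → Term
  var : JVar → Term
  _·_ : Term → Term → Term
  _⊕_ : Term → Term → Term

infixl 7 _·_
infixl 6 _⊕_

data Formula : Set where
  ⊥ᶠ   : Formula
  atom : ℕ → Formula
  _⇒_  : Formula → Formula → Formula
  _∶_  : Term → Formula → Formula

infixr 4 _⇒_
infix  5 _∶_

¬ᶠ_ : Formula → Formula
¬ᶠ A = A ⇒ ⊥ᶠ

_∧ᶠ_ : Formula → Formula → Formula
A ∧ᶠ B = ¬ᶠ (A ⇒ ¬ᶠ B)

_∨ᶠ_ : Formula → Formula → Formula
A ∨ᶠ B = (¬ᶠ A) ⇒ B

_⇔ᶠ_ : Formula → Formula → Formula
A ⇔ᶠ B = (A ⇒ B) ∧ᶠ (B ⇒ A)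

infixr 4 _⇔ᶠ_
infixr 5 _∨ᶠ_
infixr 6 _∧ᶠ_

_⟨_≔_⟩ₜ : Term → JVar → Term → Term
𝟘       ⟨ w ≔ t ⟩ₜ = 𝟘
𝟙       ⟨ w ≔ t ⟩ₜ = 𝟙
cst i   ⟨ w ≔ t ⟩ₜ = cst i
var x   ⟨ w ≔ t ⟩ₜ = if x ≡ᵇ w then t else var x
(r · s) ⟨ w ≔ t ⟩ₜ = (r ⟨ w ≔ t ⟩ₜ) · (s ⟨ w ≔ t ⟩ₜ)
(r ⊕ s) ⟨ w ≔ t ⟩ₜ = (r ⟨ w ≔ t ⟩ₜ) ⊕ (s ⟨ w ≔ t ⟩ₜ)

_[_/_] : Formula → JVar → Term → Formula
⊥ᶠ      [ w / t ] = ⊥ᶠ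
atom p  [ w / t ] = atom p
(A ⇒ B) [ w / t ] = (A [ w / t ]) ⇒ (B [ w / t ])
(s ∶ A) [ w / t ] = (s ⟨ w ≔ t ⟩ₜ) ∶ (A [ w / t ])

-- Propositional tautologies: formulas true under every Boolean
-- valuation of the prime formulas (atoms and justification assertions
-- t : A), with ⊥ false and → classical implication.

eval : (Formula → Bool) → Formula → Bool
eval v ⊥ᶠ        = false
eval v (atom p)  = v (atom p)
eval v (A ⇒ B)   = not (eval v A) ∨ eval v B
eval v (s ∶ A)   = v (s ∶ A)

Tautology : Formula → Set
Tautology A = (v : Formula → Bool) → eval v A ≡ true

data Axiom : Formula → Set where
  ax-CL  : ∀ {A} → Tautology A → Axiom A
  ax-j   : ∀ A B (x y : JVar) →
           Axiom ((var x ∶ (A ⇒ B)) ⇒ ((var y ∶ A) ⇒ (var x · var y ∶ B)))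
  ax-j+  : ∀ A (x y : JVar) →
           Axiom (((var x ∶ A) ∧ᶠ (var y ∶ A)) ⇒ (var x ⊕ var y ∶ A))
  ax-a+  : ∀ A (w x y z : JVar) →
           Axiom ((A [ w / (var x ⊕ var y) ⊕ var z ]) ⇒ (A [ w / var x ⊕ (var y ⊕ var z) ]))
  ax-c+  : ∀ A (w x y : JVar) →
           Axiom ((A [ w / var x ⊕ var y ]) ⇒ (A [ w / var y ⊕ var x ]))
  ax-0+  : ∀ A (w x : JVar) →
           Axiom ((A [ w / var x ⊕ 𝟘 ]) ⇔ᶠ (A [ w / var x ]))
  ax-am  : ∀ A (w x y z : JVar) →
           Axiom ((A [ w / (var x · var y) · var z ]) ⇔ᶠ (A [ w / var x · (var y · var z) ]))
  ax-a0r : ∀ A (w x : JVar) →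
           Axiom ((A [ w / var x · 𝟘 ]) ⇔ᶠ (A [ w / 𝟘 ]))
  ax-a0l : ∀ A (w x : JVar) →
           Axiom ((A [ w / 𝟘 · var x ]) ⇔ᶠ (A [ w / 𝟘 ]))
  ax-a1r : ∀ A (w x : JVar) →
           Axiom ((A [ w / var x · 𝟙 ]) ⇔ᶠ (A [ w / var x ]))
  ax-a1l : ∀ A (w x : JVar) →
           Axiom ((A [ w / 𝟙 · var x ]) ⇔ᶠ (A [ w / var x ]))
  ax-dl  : ∀ A (w x y z : JVar) →
           Axiom ((A [ w / var x · (var y ⊕ var z) ]) ⇔ᶠ (A [ w / var x · var y ⊕ var x · var z ]))
  ax-dr  : ∀ A (w x y z : JVar) →
           Axiom ((A [ w / (var y ⊕ var z) · var x ]) ⇔ᶠ (A [ w / var y · var x ⊕ var z · var x ]))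

Theory : Set₁
Theory = Formula → Set

data _⊢SE_ (T : Theory) : Formula → Set where
  hyp : ∀ {A} → T A → T ⊢SE A
  ax  : ∀ {A} → Axiom A → T ⊢SE A
  mp  : ∀ {A B} → T ⊢SE (A ⇒ B) → T ⊢SE A → T ⊢SE B
  jv  : ∀ {A} (x : JVar) (t : Term) → T ⊢SE A → T ⊢SE (A [ x / t ])

infix 2 _⊢SE_

-- [s] = [t]: equality in the free semiring over JConst ∪ JVar, i.e. the
-- least congruence on terms containing the semiring axioms.

data _≈ₛ_ : Term → Term → Set where
  ≈-refl  : ∀ {s} → s ≈ₛ s
  ≈-sym   : ∀ {s t} → s ≈ₛ t → t ≈ₛ s
  ≈-trans : ∀ {r s t} → r ≈ₛ s → s ≈ₛ t → r ≈ₛ t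
  ≈-cong· : ∀ {s s' t t'} → s ≈ₛ s' → t ≈ₛ t' → s · t ≈ₛ s' · t'
  ≈-cong⊕ : ∀ {s s' t t'} → s ≈ₛ s' → t ≈ₛ t' → s ⊕ t ≈ₛ s' ⊕ t'
  ⊕-assoc : ∀ r s t → (r ⊕ s) ⊕ t ≈ₛ r ⊕ (s ⊕ t)
  ⊕-comm  : ∀ s t → s ⊕ t ≈ₛ t ⊕ s
  ⊕-idʳ   : ∀ s → s ⊕ 𝟘 ≈ₛ s
  ·-assoc : ∀ r s t → (r · s) · t ≈ₛ r · (s · t)
  ·-idˡ   : ∀ s → 𝟙 · s ≈ₛ s
  ·-idʳ   : ∀ s → s · 𝟙 ≈ₛ s
  ·-zeroˡ : ∀ s → 𝟘 · s ≈ₛ 𝟘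
  ·-zeroʳ : ∀ s → s · 𝟘 ≈ₛ 𝟘
  distribˡ : ∀ r s t → r · (s ⊕ t) ≈ₛ r · s ⊕ r · t
  distribʳ : ∀ r s t → (s ⊕ t) · r ≈ₛ s · r ⊕ t · r

infix 4 _≈ₛ_

-- Write s ⊑ t when T ⊢ A[w/s] → A[w/t] for every formula A and variable w.  Because A is
-- arbitrary, ⊑ is a precongruence: applying s ⊑ s′ to the formula A[w/C[v]] with v fresh gives
-- C[s] ⊑ C[s′].  Each semiring law holds for variables by an axiom of SE, and the rule jv, applied
-- to fresh variables one at a time, instantiates it with arbitrary terms; the one law SE states
-- in a single direction, associativity of +, is reversed using commutativity.  So [s] = [t]
-- gives s ⊑ t and t ⊑ s, and modus ponens concludes.
module Submission where

open import Defs
open import Data.Bool using (true; false)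
open import Data.Nat using (ℕ; suc; _≤_; _⊔_; _≡ᵇ_)
open import Data.Nat.Properties using (≡ᵇ⇒≡; ≡⇒≡ᵇ; <⇒≢; ≤-refl; ≤-trans; m≤n⇒m≤1+n; m≤m⊔n; m≤n⊔m; m⊔n≤o⇒m≤o; m⊔n≤o⇒n≤o)
open import Data.Product using (_×_; _,_; proj₁; proj₂; swap)
open import Function using (_∘_)
open import Relation.Binary.PropositionalEquality using (_≡_; refl; trans; cong; cong₂; subst₂; module ≡-Reasoning)
open import Relation.Nullary using (contradiction)
import Relation.Binary.Reasoning.Base.Single
open import Algebra.Morphism.Definitions Term Term _≡_ using (Homomorphic₂)

-- All variables of p are below varBound p, so every u ≥ varBound p is fresh for p.
varBound : Term → ℕ
varBound 𝟘       = 0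
varBound 𝟙       = 0
varBound (cst _) = 0
varBound (var x) = suc x
varBound (p · q) = varBound p ⊔ varBound q
varBound (p ⊕ q) = varBound p ⊔ varBound q

varBoundᶠ : Formula → ℕ
varBoundᶠ ⊥ᶠ       = 0
varBoundᶠ (atom _) = 0
varBoundᶠ (A ⇒ B)  = varBoundᶠ A ⊔ varBoundᶠ B
varBoundᶠ (s ∶ A)  = varBound s ⊔ varBoundᶠ A

var-subst-self : ∀ u r → var u ⟨ u ≔ r ⟩ₜ ≡ r
var-subst-self u r with u ≡ᵇ u | ≡⇒≡ᵇ u u refl
... | true | _ = refl

var-subst-fresh : ∀ x u r → suc x ≤ u → var x ⟨ u ≔ r ⟩ₜ ≡ var x
var-subst-fresh x u r x<u with x ≡ᵇ u | ≡ᵇ⇒≡ x u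
... | false | _       = refl
... | true  | x≡ᵇu⇒x≡u = contradiction (x≡ᵇu⇒x≡u _) (<⇒≢ x<u)

subst-fresh : ∀ p {u} r → varBound p ≤ u → p ⟨ u ≔ r ⟩ₜ ≡ p
subst-fresh 𝟘       r _ = refl
subst-fresh 𝟙       r _ = refl
subst-fresh (cst _) r _ = refl
subst-fresh (var x) r h = var-subst-fresh x _ r h
subst-fresh (p · q) r h = cong₂ _·_ (subst-fresh p r (m⊔n≤o⇒m≤o _ _ h)) (subst-fresh q r (m⊔n≤o⇒n≤o _ _ h))
subst-fresh (p ⊕ q) r h = cong₂ _⊕_ (subst-fresh p r (m⊔n≤o⇒m≤o _ _ h)) (subst-fresh q r (m⊔n≤o⇒n≤o _ _ h))

subst-subst : ∀ p w q {u} r → varBound p ≤ u → p ⟨ w ≔ q ⟩ₜ ⟨ u ≔ r ⟩ₜ ≡ p ⟨ w ≔ q ⟨ u ≔ r ⟩ₜ ⟩ₜ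
subst-subst 𝟘        w q r _ = refl
subst-subst 𝟙        w q r _ = refl
subst-subst (cst _)  w q r _ = refl
subst-subst (var x)  w q r h with x ≡ᵇ w
... | true  = refl
... | false = var-subst-fresh x _ r h
subst-subst (p · p′) w q r h =
  cong₂ _·_ (subst-subst p w q r (m⊔n≤o⇒m≤o _ _ h)) (subst-subst p′ w q r (m⊔n≤o⇒n≤o _ _ h))
subst-subst (p ⊕ p′) w q r h =
  cong₂ _⊕_ (subst-subst p w q r (m⊔n≤o⇒m≤o _ _ h)) (subst-subst p′ w q r (m⊔n≤o⇒n≤o _ _ h))

[/]-[/] : ∀ A w q {u} r → varBoundᶠ A ≤ u → A [ w / q ] [ u / r ] ≡ A [ w / q ⟨ u ≔ r ⟩ₜ ]
[/]-[/] ⊥ᶠ       w q r _ = refl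
[/]-[/] (atom _) w q r _ = refl
[/]-[/] (A ⇒ B)  w q r h = cong₂ _⇒_ ([/]-[/] A w q r (m⊔n≤o⇒m≤o _ _ h)) ([/]-[/] B w q r (m⊔n≤o⇒n≤o _ _ h))
[/]-[/] (s ∶ A)  w q r h = cong₂ _∶_ (subst-subst s w q r (m⊔n≤o⇒m≤o _ _ h)) ([/]-[/] A w q r (m⊔n≤o⇒n≤o _ _ h))

Substitutive₂ : (Term → Term → Term) → Set
Substitutive₂ _∙_ = ∀ u r → Homomorphic₂ (λ p → p ⟨ u ≔ r ⟩ₜ) _∙_ _∙_

-- Terms in three metavariables: the shapes of the semiring laws, which SE states for variables only.
data Schema : Set where
  v₀ v₁ v₂  : Schema
  𝟘ˢ 𝟙ˢ     : Schema
  _·ˢ_ _⊕ˢ_ : Schema → Schema → Schema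

infixl 7 _·ˢ_
infixl 6 _⊕ˢ_

⟦_⟧ : Schema → Term → Term → Term → Term
⟦ v₀ ⟧     a b c = a
⟦ v₁ ⟧     a b c = b
⟦ v₂ ⟧     a b c = c
⟦ 𝟘ˢ ⟧     a b c = 𝟘
⟦ 𝟙ˢ ⟧     a b c = 𝟙
⟦ σ ·ˢ τ ⟧ a b c = ⟦ σ ⟧ a b c · ⟦ τ ⟧ a b c
⟦ σ ⊕ˢ τ ⟧ a b c = ⟦ σ ⟧ a b c ⊕ ⟦ τ ⟧ a b c

⟦⟧-subst : ∀ σ a b c u r → ⟦ σ ⟧ a b c ⟨ u ≔ r ⟩ₜ ≡ ⟦ σ ⟧ (a ⟨ u ≔ r ⟩ₜ) (b ⟨ u ≔ r ⟩ₜ) (c ⟨ u ≔ r ⟩ₜ)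
⟦⟧-subst v₀       a b c u r = refl
⟦⟧-subst v₁       a b c u r = refl
⟦⟧-subst v₂       a b c u r = refl
⟦⟧-subst 𝟘ˢ       a b c u r = refl
⟦⟧-subst 𝟙ˢ       a b c u r = refl
⟦⟧-subst (σ ·ˢ τ) a b c u r = cong₂ _·_ (⟦⟧-subst σ a b c u r) (⟦⟧-subst τ a b c u r)
⟦⟧-subst (σ ⊕ˢ τ) a b c u r = cong₂ _⊕_ (⟦⟧-subst σ a b c u r) (⟦⟧-subst τ a b c u r)

-- Substituting for the highest variable first, no inserted term is touched by a later substitution;
-- hence r need not be fresh.
module Instantiation (N : JVar) (r s t : Term) (s≤N : varBound s ≤ N) (t≤N : varBound t ≤ N) where

  ρ₀ ρ₁ ρ₂ : Term → Term
  ρ₀ p = p ⟨ N ≔ r ⟩ₜ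
  ρ₁ p = p ⟨ suc N ≔ s ⟩ₜ
  ρ₂ p = p ⟨ suc (suc N) ≔ t ⟩ₜ

  substitute : Term → Term
  substitute = ρ₀ ∘ ρ₁ ∘ ρ₂

  substitute-N : substitute (var N) ≡ r
  substitute-N = begin
    ρ₀ (ρ₁ (ρ₂ (var N)))  ≡⟨ cong (ρ₀ ∘ ρ₁) (var-subst-fresh N _ t (m≤n⇒m≤1+n ≤-refl)) ⟩
    ρ₀ (ρ₁ (var N))       ≡⟨ cong ρ₀ (var-subst-fresh N _ s ≤-refl) ⟩
    ρ₀ (var N)            ≡⟨ var-subst-self N r ⟩
    r                     ∎
    where open ≡-Reasoning

  substitute-1+N : substitute (var (suc N)) ≡ s
  substitute-1+N = begin
    ρ₀ (ρ₁ (ρ₂ (var (suc N))))  ≡⟨ cong (ρ₀ ∘ ρ₁) (var-subst-fresh (suc N) _ t ≤-refl) ⟩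
    ρ₀ (ρ₁ (var (suc N)))       ≡⟨ cong ρ₀ (var-subst-self (suc N) s) ⟩
    ρ₀ s                        ≡⟨ subst-fresh s r s≤N ⟩
    s                           ∎
    where open ≡-Reasoning

  substitute-2+N : substitute (var (suc (suc N))) ≡ t
  substitute-2+N = begin
    ρ₀ (ρ₁ (ρ₂ (var (suc (suc N)))))  ≡⟨ cong (ρ₀ ∘ ρ₁) (var-subst-self (suc (suc N)) t) ⟩
    ρ₀ (ρ₁ t)                         ≡⟨ cong ρ₀ (subst-fresh t s (m≤n⇒m≤1+n t≤N)) ⟩
    ρ₀ t                              ≡⟨ subst-fresh t r t≤N ⟩
    t                                 ∎
    where open ≡-Reasoning

  substitute-⟦⟧ : ∀ σ a b c → substitute (⟦ σ ⟧ a b c) ≡ ⟦ σ ⟧ (substitute a) (substitute b) (substitute c)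
  substitute-⟦⟧ σ a b c = begin
    ρ₀ (ρ₁ (ρ₂ (⟦ σ ⟧ a b c)))              ≡⟨ cong (ρ₀ ∘ ρ₁) (⟦⟧-subst σ a b c _ t) ⟩
    ρ₀ (ρ₁ (⟦ σ ⟧ (ρ₂ a) (ρ₂ b) (ρ₂ c)))    ≡⟨ cong ρ₀ (⟦⟧-subst σ (ρ₂ a) (ρ₂ b) (ρ₂ c) _ s) ⟩
    ρ₀ (⟦ σ ⟧ (ρ₁ (ρ₂ a)) (ρ₁ (ρ₂ b)) (ρ₁ (ρ₂ c)))
                                            ≡⟨ ⟦⟧-subst σ (ρ₁ (ρ₂ a)) (ρ₁ (ρ₂ b)) (ρ₁ (ρ₂ c)) _ r ⟩
    ⟦ σ ⟧ (substitute a) (substitute b) (substitute c) ∎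
    where open ≡-Reasoning

  instantiate : ∀ σ → substitute (⟦ σ ⟧ (var N) (var (suc N)) (var (suc (suc N)))) ≡ ⟦ σ ⟧ r s t
  instantiate σ = begin
    substitute (⟦ σ ⟧ (var N) (var (suc N)) (var (suc (suc N))))
      ≡⟨ substitute-⟦⟧ σ (var N) (var (suc N)) (var (suc (suc N))) ⟩
    ⟦ σ ⟧ (substitute (var N)) (substitute (var (suc N))) (substitute (var (suc (suc N))))
      ≡⟨ cong₂ (λ a b → ⟦ σ ⟧ a b (substitute (var (suc (suc N))))) substitute-N substitute-1+N ⟩
    ⟦ σ ⟧ r s (substitute (var (suc (suc N))))
      ≡⟨ cong (⟦ σ ⟧ r s) substitute-2+N ⟩
    ⟦ σ ⟧ r s t
      ∎
    where open ≡-Reasoning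

taut-refl : ∀ X → Tautology (X ⇒ X)
taut-refl X v with eval v X
... | true  = refl
... | false = refl

taut-trans : ∀ X Y Z → Tautology ((X ⇒ Y) ⇒ (Y ⇒ Z) ⇒ (X ⇒ Z))
taut-trans X Y Z v with eval v X | eval v Y | eval v Z
... | true  | true  | true  = refl
... | true  | true  | false = refl
... | true  | false | _     = refl
... | false | true  | true  = refl
... | false | true  | false = refl
... | false | false | _     = refl

taut-⇔-to : ∀ X Y → Tautology ((X ⇔ᶠ Y) ⇒ (X ⇒ Y))
taut-⇔-to X Y v with eval v X | eval v Y
... | true  | true  = refl
... | true  | false = refl
... | false | true  = refl
... | false | false = refl

taut-⇔-from : ∀ X Y → Tautology ((X ⇔ᶠ Y) ⇒ (Y ⇒ X))
taut-⇔-from X Y v with eval v X | eval v Y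
... | true  | true  = refl
... | true  | false = refl
... | false | true  = refl
... | false | false = refl

module Replacement (T : Theory) where

  ⊢-trans : ∀ {X Y Z} → T ⊢SE X ⇒ Y → T ⊢SE Y ⇒ Z → T ⊢SE X ⇒ Z
  ⊢-trans {X} {Y} {Z} X⇒Y Y⇒Z = mp (mp (ax (ax-CL (taut-trans X Y Z))) X⇒Y) Y⇒Z

  ⊢-⇔-to : ∀ {X Y} → T ⊢SE X ⇔ᶠ Y → T ⊢SE X ⇒ Y
  ⊢-⇔-to {X} {Y} = mp (ax (ax-CL (taut-⇔-to X Y)))

  ⊢-⇔-from : ∀ {X Y} → T ⊢SE X ⇔ᶠ Y → T ⊢SE Y ⇒ X
  ⊢-⇔-from {X} {Y} = mp (ax (ax-CL (taut-⇔-from X Y)))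

  ⊢-⇒-subst : ∀ A w p q {u} r → varBoundᶠ A ≤ u →
              T ⊢SE A [ w / p ] ⇒ A [ w / q ] → T ⊢SE A [ w / p ⟨ u ≔ r ⟩ₜ ] ⇒ A [ w / q ⟨ u ≔ r ⟩ₜ ]
  ⊢-⇒-subst A w p q {u} r A≤u =
    subst₂ (λ F G → T ⊢SE F ⇒ G) ([/]-[/] A w p r A≤u) ([/]-[/] A w q r A≤u) ∘ jv u r

  _⊑_ : Term → Term → Set
  s ⊑ t = ∀ A w → T ⊢SE A [ w / s ] ⇒ A [ w / t ]

  _≋_ : Term → Term → Set
  s ≋ t = s ⊑ t × t ⊑ s

  infix 4 _⊑_ _≋_

  ⊑-refl : ∀ {s} → s ⊑ s
  ⊑-refl {s} A w = ax (ax-CL (taut-refl (A [ w / s ])))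

  ⊑-trans : ∀ {r s t} → r ⊑ s → s ⊑ t → r ⊑ t
  ⊑-trans r⊑s s⊑t A w = ⊢-trans (r⊑s A w) (s⊑t A w)

  module ⊑-Reasoning = Relation.Binary.Reasoning.Base.Single _⊑_ ⊑-refl ⊑-trans

  ⊑-plug : ∀ c u {s s′} → s ⊑ s′ → c ⟨ u ≔ s ⟩ₜ ⊑ c ⟨ u ≔ s′ ⟩ₜ
  ⊑-plug c u {s} {s′} s⊑s′ A w =
    subst₂ (λ F G → T ⊢SE F ⇒ G) (plug s) (plug s′) (s⊑s′ (A [ w / c ⟨ u ≔ var v ⟩ₜ ]) v)
    where
    v : JVar
    v = varBoundᶠ A ⊔ varBound c

    plug : ∀ r → A [ w / c ⟨ u ≔ var v ⟩ₜ ] [ v / r ] ≡ A [ w / c ⟨ u ≔ r ⟩ₜ ]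
    plug r = begin
      A [ w / c ⟨ u ≔ var v ⟩ₜ ] [ v / r ]   ≡⟨ [/]-[/] A w _ r (m≤m⊔n _ _) ⟩
      A [ w / c ⟨ u ≔ var v ⟩ₜ ⟨ v ≔ r ⟩ₜ ]  ≡⟨ cong (λ q → A [ w / q ]) (subst-subst c u (var v) r (m≤n⊔m _ _)) ⟩
      A [ w / c ⟨ u ≔ var v ⟨ v ≔ r ⟩ₜ ⟩ₜ ]  ≡⟨ cong (λ q → A [ w / c ⟨ u ≔ q ⟩ₜ ]) (var-subst-self v r) ⟩
      A [ w / c ⟨ u ≔ r ⟩ₜ ]                 ∎
      where open ≡-Reasoning

  ⊑-cong : ∀ {_∙_} → Substitutive₂ _∙_ → ∀ {s s′ t t′} → s ⊑ s′ → t ⊑ t′ → s ∙ t ⊑ s′ ∙ t′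
  ⊑-cong {_∙_} ∙-subst {s} {s′} {t} {t′} s⊑s′ t⊑t′ =
    ⊑-trans (subst₂ _⊑_ (plugˡ s) (plugˡ s′) (⊑-plug (var u ∙ t) u s⊑s′))
            (subst₂ _⊑_ (plugʳ t) (plugʳ t′) (⊑-plug (s′ ∙ var u′) u′ t⊑t′))
    where
    u u′ : JVar
    u  = varBound t
    u′ = varBound s′

    plugˡ : ∀ r → (var u ∙ t) ⟨ u ≔ r ⟩ₜ ≡ r ∙ t
    plugˡ r = trans (∙-subst u r (var u) t) (cong₂ _∙_ (var-subst-self u r) (subst-fresh t r ≤-refl))

    plugʳ : ∀ r → (s′ ∙ var u′) ⟨ u′ ≔ r ⟩ₜ ≡ s′ ∙ r
    plugʳ r = trans (∙-subst u′ r s′ (var u′)) (cong₂ _∙_ (subst-fresh s′ r ≤-refl) (var-subst-self u′ r))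

  ≋-trans : ∀ {r s t} → r ≋ s → s ≋ t → r ≋ t
  ≋-trans (r⊑s , s⊑r) (s⊑t , t⊑s) = ⊑-trans r⊑s s⊑t , ⊑-trans t⊑s s⊑r

  ≋-cong : ∀ {_∙_} → Substitutive₂ _∙_ → ∀ {s s′ t t′} → s ≋ s′ → t ≋ t′ → s ∙ t ≋ s′ ∙ t′
  ≋-cong ∙-subst (s⊑s′ , s′⊑s) (t⊑t′ , t′⊑t) = ⊑-cong ∙-subst s⊑s′ t⊑t′ , ⊑-cong ∙-subst s′⊑s t′⊑t

  ⊑-instance : ∀ σ τ → (∀ x y z → ⟦ σ ⟧ (var x) (var y) (var z) ⊑ ⟦ τ ⟧ (var x) (var y) (var z)) →
               ∀ r s t → ⟦ σ ⟧ r s t ⊑ ⟦ τ ⟧ r s t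
  ⊑-instance σ τ law r s t A w =
    subst₂ (λ p q → T ⊢SE A [ w / p ] ⇒ A [ w / q ]) (instantiate σ) (instantiate τ)
      (⊢-⇒-subst A w _ _ r A≤N
        (⊢-⇒-subst A w _ _ s (m≤n⇒m≤1+n A≤N)
          (⊢-⇒-subst A w _ _ t (m≤n⇒m≤1+n (m≤n⇒m≤1+n A≤N))
            (law N (suc N) (suc (suc N)) A w))))
    where
    N : JVar
    N = varBoundᶠ A ⊔ varBound s ⊔ varBound t

    A≤N : varBoundᶠ A ≤ N
    A≤N = ≤-trans (m≤m⊔n (varBoundᶠ A) (varBound s)) (m≤m⊔n _ (varBound t))
    s≤N : varBound s ≤ N
    s≤N = ≤-trans (m≤n⊔m (varBoundᶠ A) (varBound s)) (m≤m⊔n _ (varBound t))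
    t≤N : varBound t ≤ N
    t≤N = m≤n⊔m (varBoundᶠ A ⊔ varBound s) (varBound t)

    open Instantiation N r s t s≤N t≤N using (instantiate)

  ≋-instance : ∀ σ τ → (∀ x y z → ⟦ σ ⟧ (var x) (var y) (var z) ≋ ⟦ τ ⟧ (var x) (var y) (var z)) →
               ∀ r s t → ⟦ σ ⟧ r s t ≋ ⟦ τ ⟧ r s t
  ≋-instance σ τ law r s t =
    ⊑-instance σ τ (λ x y z → proj₁ (law x y z)) r s t , ⊑-instance τ σ (λ x y z → proj₂ (law x y z)) r s t

  ⇔-schema⇒≋ : ∀ {p q} → (∀ A w → T ⊢SE A [ w / p ] ⇔ᶠ A [ w / q ]) → p ≋ q
  ⇔-schema⇒≋ p⇔q = (λ A w → ⊢-⇔-to (p⇔q A w)) , (λ A w → ⊢-⇔-from (p⇔q A w))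

  ⊕-assoc-⊑ : ∀ r s t → (r ⊕ s) ⊕ t ⊑ r ⊕ (s ⊕ t)
  ⊕-assoc-⊑ = ⊑-instance (v₀ ⊕ˢ v₁ ⊕ˢ v₂) (v₀ ⊕ˢ (v₁ ⊕ˢ v₂)) (λ x y z A w → ax (ax-a+ A w x y z))

  ⊕-comm-⊑ : ∀ s t → s ⊕ t ⊑ t ⊕ s
  ⊕-comm-⊑ s t = ⊑-instance (v₀ ⊕ˢ v₁) (v₁ ⊕ˢ v₀) (λ x y _ A w → ax (ax-c+ A w x y)) s t 𝟘

  ⊕-assoc-⊒ : ∀ r s t → r ⊕ (s ⊕ t) ⊑ (r ⊕ s) ⊕ t
  ⊕-assoc-⊒ r s t = begin
    r ⊕ (s ⊕ t)   ∼⟨ ⊕-comm-⊑ r (s ⊕ t) ⟩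
    (s ⊕ t) ⊕ r   ∼⟨ ⊕-assoc-⊑ s t r ⟩
    s ⊕ (t ⊕ r)   ∼⟨ ⊕-comm-⊑ s (t ⊕ r) ⟩
    (t ⊕ r) ⊕ s   ∼⟨ ⊕-assoc-⊑ t r s ⟩
    t ⊕ (r ⊕ s)   ∼⟨ ⊕-comm-⊑ t (r ⊕ s) ⟩
    (r ⊕ s) ⊕ t   ∎
    where open ⊑-Reasoning

  ≈ₛ⇒≋ : ∀ {s t} → s ≈ₛ t → s ≋ t
  ≈ₛ⇒≋ ≈-refl              = ⊑-refl , ⊑-refl
  ≈ₛ⇒≋ (≈-sym s≈t)         = swap (≈ₛ⇒≋ s≈t)
  ≈ₛ⇒≋ (≈-trans r≈s s≈t)   = ≋-trans (≈ₛ⇒≋ r≈s) (≈ₛ⇒≋ s≈t)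
  ≈ₛ⇒≋ (≈-cong· s≈s′ t≈t′) = ≋-cong (λ _ _ _ _ → refl) (≈ₛ⇒≋ s≈s′) (≈ₛ⇒≋ t≈t′)
  ≈ₛ⇒≋ (≈-cong⊕ s≈s′ t≈t′) = ≋-cong (λ _ _ _ _ → refl) (≈ₛ⇒≋ s≈s′) (≈ₛ⇒≋ t≈t′)
  ≈ₛ⇒≋ (⊕-assoc r s t)     = ⊕-assoc-⊑ r s t , ⊕-assoc-⊒ r s t
  ≈ₛ⇒≋ (⊕-comm s t)        = ⊕-comm-⊑ s t , ⊕-comm-⊑ t s
  ≈ₛ⇒≋ (⊕-idʳ s)           = ≋-instance (v₀ ⊕ˢ 𝟘ˢ) v₀ (λ x _ _ → ⇔-schema⇒≋ λ A w → ax (ax-0+ A w x)) s 𝟘 𝟘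
  ≈ₛ⇒≋ (·-assoc r s t)     =
    ≋-instance (v₀ ·ˢ v₁ ·ˢ v₂) (v₀ ·ˢ (v₁ ·ˢ v₂)) (λ x y z → ⇔-schema⇒≋ λ A w → ax (ax-am A w x y z)) r s t
  ≈ₛ⇒≋ (·-idˡ s)           = ≋-instance (𝟙ˢ ·ˢ v₀) v₀ (λ x _ _ → ⇔-schema⇒≋ λ A w → ax (ax-a1l A w x)) s 𝟘 𝟘
  ≈ₛ⇒≋ (·-idʳ s)           = ≋-instance (v₀ ·ˢ 𝟙ˢ) v₀ (λ x _ _ → ⇔-schema⇒≋ λ A w → ax (ax-a1r A w x)) s 𝟘 𝟘
  ≈ₛ⇒≋ (·-zeroˡ s)         = ≋-instance (𝟘ˢ ·ˢ v₀) 𝟘ˢ (λ x _ _ → ⇔-schema⇒≋ λ A w → ax (ax-a0l A w x)) s 𝟘 𝟘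
  ≈ₛ⇒≋ (·-zeroʳ s)         = ≋-instance (v₀ ·ˢ 𝟘ˢ) 𝟘ˢ (λ x _ _ → ⇔-schema⇒≋ λ A w → ax (ax-a0r A w x)) s 𝟘 𝟘
  ≈ₛ⇒≋ (distribˡ r s t)    =
    ≋-instance (v₀ ·ˢ (v₁ ⊕ˢ v₂)) (v₀ ·ˢ v₁ ⊕ˢ v₀ ·ˢ v₂) (λ x y z → ⇔-schema⇒≋ λ A w → ax (ax-dl A w x y z)) r s t
  ≈ₛ⇒≋ (distribʳ r s t)    =
    ≋-instance ((v₁ ⊕ˢ v₂) ·ˢ v₀) (v₁ ·ˢ v₀ ⊕ˢ v₂ ·ˢ v₀) (λ x y z → ⇔-schema⇒≋ λ A w → ax (ax-dr A w x y z)) r s t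

open Replacement using (≈ₛ⇒≋)

mainTheorem10 : (T : Theory) (s t : Term) → s ≈ₛ t → (A : Formula) (w : JVar) →
                  ((T ⊢SE A [ w / s ]) → (T ⊢SE A [ w / t ])) × ((T ⊢SE A [ w / t ]) → (T ⊢SE A [ w / s ]))
mainTheorem10 T s t s≈t A w = mp (proj₁ (≈ₛ⇒≋ T s≈t) A w) , mp (proj₂ (≈ₛ⇒≋ T s≈t) A w)
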